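{- Let $d\geq 3$, let $s,k$ be positive integers (sufficiently large with respect to $d$), let $m=s^k$, $M=m^{d-1}$, and let $T$, $\mathcal{B}$, $G$ be as defined in the context. Suppose $s\geq |T|^3$. Then there exists a collection $\mathcal{C}$ of subsets of $\mathcal{B}$ such that (1) every $C\in\mathcal{C}$ satisfies $|C|\leq 3M$; (2) $|\mathcal{C}|\leq e^{(\log s) M|T|^3/s}$; (3) every independent set of $G$ is contained in some element of $\mathcal{C}$.
   Context: Here $\mathbb{N}=\{0,1,2,\dots\}$ and $\log$ is the natural logarithm. For $\mathbf{t}\in\mathbb{N}^d$ and $\mathbf{p}\in\mathbb{Z}^d$, the $\mathbf{t}$-block $B_{\mathbf{t}}(\mathbf{p})$ is the half-open box $\prod_{i=1}^d [s^{\mathbf{t}(i)}\mathbf{p}(i), s^{\mathbf{t}(i)}(\mathbf{p}(i)+1))$. Let $T=\{\mathbf{t}\in\mathbb{N}^d:\sum_{i=1}^d\mathbf{t}(i)=k\}$, and let $\mathcal{B}$ be the family of all blocks $B_{\mathbf{t}}(\mathbf{p})$ with $\mathbf{t}\in T$ and $\mathbf{p}(i)\in\{0,\dots,s^{k-\mathbf{t}(i)}-1\}$ for every $i\in[d]$. $G$ is the intersection graph of $\mathcal{B}$: vertex set $\mathcal{B}$, two blocks adjacent iff they have nonempty intersection. -}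

module Defs where

open import Data.Nat using (ℕ; _+_; _*_; _∸_; _^_; _≤_; _<_; suc)
open import Data.Vec using (Vec; lookup)
open import Data.Vec.Functional using () 
open import Data.Fin using (Fin)
open import Data.List using (List; length)
open import Data.List.Membership.Propositional using (_∈_)
open import Data.List.Relation.Unary.All using (All)
open import Data.List.Relation.Unary.Unique.Propositional using (Unique)
open import Data.Product using (Σ; _×_; ∃-syntax; _,_)
open import Relation.Binary.PropositionalEquality using (_≡_; _≢_)
open import Relation.Nullary using (¬_)
open import Function.Bundles using (_⇔_)
import Data.Vec as V

HasSize : {A : Set} → (A → Set) → ℕ → Set
HasSize {A} P n = Σ (List A) λ L → Unique L × (∀ x → (x ∈ L) ⇔ P x) × (length L ≡ n)

InT : (d k : ℕ) → Vec ℕ d → Set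
InT d k t = V.sum t ≡ k

-- A block is given by its data (t , p); B_t(p) = ∏_i [ s^{t(i)} p(i) , s^{t(i)} (p(i)+1) ).
Block : ℕ → Set
Block d = Vec ℕ d × Vec ℕ d

InB : (d s k : ℕ) → Block d → Set
InB d s k (t , p) = InT d k t × (∀ (i : Fin d) → lookup p i < s ^ (k ∸ lookup t i))

_∈Box_ : {d : ℕ} → Vec ℕ d → ℕ × Block d → Set
_∈Box_ {d} x (s , (t , p)) =
  ∀ (i : Fin d) → (s ^ lookup t i * lookup p i ≤ lookup x i)
                × (lookup x i < s ^ lookup t i * suc (lookup p i))

Intersect : (d s : ℕ) → Block d → Block d → Set
Intersect d s b b' = ∃[ x ] (x ∈Box (s , b) × x ∈Box (s , b'))

Adj : (d s : ℕ) → Block d → Block d → Set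
Adj d s b b' = b ≢ b' × Intersect d s b b'

Independent : (d s k : ℕ) → List (Block d) → Set
Independent d s k I = All (InB d s k) I × (∀ b b' → b ∈ I → b' ∈ I → ¬ Adj d s b b')

{-# OPTIONS --safe #-}
-- Double counting over the lattice points of [0, m)^d, m = s^k, bounds the blocks of a set U:
-- every block has m points, and two distinct blocks meet in at most m/s points, because their
-- scale vectors have the same sum k. Hence s|U| ≤ sM + Σ_{b ∈ U} deg_U(b), and a set of blocks
-- in which every degree is below s/2 has at most 2M elements. The Kleitman–Winston algorithm
-- then encodes each independent set I by a fingerprint F ⊆ I with s|F| ≤ 2|𝓑| together with a
-- remainder of at most 2M blocks that depends on F only. As |𝓑| = M|T| and 2|T| ≤ s, the
-- containers F ∪ R(F) have at most 3M elements, and there are at most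
-- (1 + |𝓑|)^(2|𝓑|/s) ≤ (sM)^(2M|T|/s) = s^((1 + k(d-1)) 2M|T|/s) ≤ s^(M|T|³/s) of them,
-- since k < |T| and 2d ≤ k give 2(1 + k(d-1)) ≤ |T|².
module Submission where

open import Defs
open import Algebra.Properties.CommutativeSemigroup as CommSemigroupProperties using ()
open import Data.Fin using (Fin; zero; suc; toℕ)
open import Data.Fin.Properties using (pigeonhole; toℕ-injective; toℕ≤pred[n]) renaming (<⇒≢ to <⇒≢ᶠ)
open import Data.List
  using (List; []; _∷_; _++_; map; length; filter; downFrom; cartesianProductWith; concatMap; deduplicate)
open import Data.List.Membership.Propositional using (_∈_; find)
open import Data.List.Membership.Propositional.Properties
  using ( ∈-cartesianProductWith⁺; ∈-cartesianProductWith⁻; ∈-downFrom⁺; ∈-downFrom⁻; ∈-filter⁺; ∈-filter⁻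
        ; ∈-++⁺ˡ; ∈-++⁺ʳ; ∈-++⁻; ∈-map⁺; ∈-map⁻; ∈-concatMap⁺; ∈-concatMap⁻
        ; ∈-deduplicate⁺; ∈-deduplicate⁻)
open import Data.List.Properties
  using ( length-++; length-map; length-downFrom; length-deduplicate
        ; filter-accept; filter-reject; filter-all; filter-notAll)
open import Data.List.Relation.Binary.Subset.Propositional using (_⊆_)
open import Data.List.Relation.Unary.All as All using (All; []; _∷_)
import Data.List.Relation.Unary.All.Properties as All
open import Data.List.Relation.Unary.Any as Any using (Any; here; there; any?)
import Data.List.Relation.Unary.Any.Properties as Any
open import Data.List.Relation.Unary.Unique.Propositional using (Unique; []; _∷_)
import Data.List.Relation.Unary.Unique.Propositional.Properties as Unique
open import Data.List.Relation.Unary.Unique.DecPropositional.Properties using (deduplicate-!)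
open import Data.Nat
open import Data.Nat.DivMod using (_/_; m*n/n≡m; m/n*n≤m; /-monoˡ-≤)
open import Data.Nat.ListAction using (sum)
open import Data.Nat.Properties
open import Data.Nat.Tactic.RingSolver using (solve-∀)
open import Data.Product using (Σ; _×_; _,_; proj₁; proj₂; ∃-syntax)
open import Data.Product.Properties using () renaming (≡-dec to ×-≡-dec)
open import Data.Sum using (_⊎_; inj₁; inj₂)
open import Data.Vec using (Vec; []; _∷_; lookup; replicate)
import Data.Vec as V
open import Data.Vec.Properties using (≡-dec; lookup-map)
open import Data.Vec.Relation.Binary.Pointwise.Inductive as Pointwise using (Pointwise; []; _∷_)
import Data.Vec.Relation.Unary.All as VecAll
open VecAll using ([]; _∷_)
open import Function using (_∘_; _∘′_)
open import Function.Bundles using (_⇔_; Equivalence)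
open import Relation.Binary using (DecidableEquality; tri<; tri≈; tri>)
open import Relation.Binary.PropositionalEquality
  using (_≡_; _≢_; refl; sym; trans; cong; cong₂; subst; module ≡-Reasoning)
open import Relation.Nullary using (Dec; yes; no; ¬_; ¬?; _×-dec_; contradiction)

open CommSemigroupProperties +-commutativeSemigroup
  using () renaming (interchange to +-interchange; x∙yz≈y∙xz to x+[y+z]≡y+[x+z])
open CommSemigroupProperties *-commutativeSemigroup
  using () renaming (interchange to *-interchange; x∙yz≈y∙xz to x*[y*z]≡y*[x*z])

private variable
  A B C : Set
  d : ℕ

∑ : List A → (A → ℕ) → ℕ
∑ xs f = sum (map f xs)

∑-cong : ∀ (xs : List A) {f g : A → ℕ} → (∀ {x} → x ∈ xs → f x ≡ g x) → ∑ xs f ≡ ∑ xs g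
∑-cong []       eq = refl
∑-cong (x ∷ xs) eq = cong₂ _+_ (eq (here refl)) (∑-cong xs (eq ∘′ there))

∑-mono : ∀ (xs : List A) {f g : A → ℕ} → (∀ {x} → x ∈ xs → f x ≤ g x) → ∑ xs f ≤ ∑ xs g
∑-mono []       le = z≤n
∑-mono (x ∷ xs) le = +-mono-≤ (le (here refl)) (∑-mono xs (le ∘′ there))

∑-+ : ∀ (xs : List A) (f g : A → ℕ) → ∑ xs (λ x → f x + g x) ≡ ∑ xs f + ∑ xs g
∑-+ []       f g = refl
∑-+ (x ∷ xs) f g = trans (cong (f x + g x +_) (∑-+ xs f g)) (+-interchange (f x) (g x) _ _)

∑-*ˡ : ∀ (xs : List A) c (f : A → ℕ) → ∑ xs (λ x → c * f x) ≡ c * ∑ xs f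
∑-*ˡ []       c f = sym (*-zeroʳ c)
∑-*ˡ (x ∷ xs) c f = trans (cong (c * f x +_) (∑-*ˡ xs c f)) (sym (*-distribˡ-+ c (f x) _))

∑-*ʳ : ∀ (xs : List A) c (f : A → ℕ) → ∑ xs (λ x → f x * c) ≡ ∑ xs f * c
∑-*ʳ xs c f = trans (∑-cong xs (λ {x} _ → *-comm (f x) c)) (trans (∑-*ˡ xs c f) (*-comm c (∑ xs f)))

∑-const : ∀ (xs : List A) c → ∑ xs (λ _ → c) ≡ c * length xs
∑-const []       c = sym (*-zeroʳ c)
∑-const (x ∷ xs) c = trans (cong (c +_) (∑-const xs c)) (sym (*-suc c (length xs)))

∑-++ : ∀ (xs ys : List A) (f : A → ℕ) → ∑ (xs ++ ys) f ≡ ∑ xs f + ∑ ys f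
∑-++ []       ys f = refl
∑-++ (x ∷ xs) ys f = trans (cong (f x +_) (∑-++ xs ys f)) (sym (+-assoc (f x) _ _))

∑-map : ∀ (g : A → B) (xs : List A) (f : B → ℕ) → ∑ (map g xs) f ≡ ∑ xs (λ x → f (g x))
∑-map g []       f = refl
∑-map g (x ∷ xs) f = cong (f (g x) +_) (∑-map g xs f)

∑-swap : ∀ (xs : List A) (ys : List B) (f : A → B → ℕ) →
         ∑ xs (λ x → ∑ ys (f x)) ≡ ∑ ys (λ y → ∑ xs (λ x → f x y))
∑-swap []       ys f = sym (∑-const ys 0)
∑-swap (x ∷ xs) ys f = trans (cong (∑ ys (f x) +_) (∑-swap xs ys f)) (sym (∑-+ ys (f x) _))

∑-cartesianProductWith : ∀ (g : A → B → C) xs ys (f : C → ℕ) →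
  ∑ (cartesianProductWith g xs ys) f ≡ ∑ xs (λ x → ∑ ys (λ y → f (g x y)))
∑-cartesianProductWith g []       ys f = refl
∑-cartesianProductWith g (x ∷ xs) ys f = begin
  ∑ (map (g x) ys ++ cartesianProductWith g xs ys) f
    ≡⟨ ∑-++ (map (g x) ys) _ f ⟩
  ∑ (map (g x) ys) f + ∑ (cartesianProductWith g xs ys) f
    ≡⟨ cong₂ _+_ (∑-map (g x) ys f) (∑-cartesianProductWith g xs ys f) ⟩
  ∑ ys (λ y → f (g x y)) + ∑ xs (λ x → ∑ ys (λ y → f (g x y))) ∎
  where open ≡-Reasoning

length-cartesianProductWith : ∀ (g : A → B → C) xs ys →
  length (cartesianProductWith g xs ys) ≡ length xs * length ys
length-cartesianProductWith g []       ys = refl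
length-cartesianProductWith g (x ∷ xs) ys =
  trans (length-++ (map (g x) ys)) (cong₂ _+_ (length-map (g x) ys) (length-cartesianProductWith g xs ys))

length-concatMap : ∀ {A B : Set} (f : A → List B) xs → length (concatMap f xs) ≡ ∑ xs (length ∘ f)
length-concatMap f []       = refl
length-concatMap f (x ∷ xs) = trans (length-++ (f x)) (cong (length (f x) +_) (length-concatMap f xs))

𝟙 : {P : Set} → Dec P → ℕ
𝟙 (yes _) = 1
𝟙 (no _)  = 0

𝟙≤1 : {P : Set} (p? : Dec P) → 𝟙 p? ≤ 1
𝟙≤1 (yes _) = s≤s z≤n
𝟙≤1 (no _)  = z≤n

𝟙-yes : {P : Set} (p? : Dec P) → P → 𝟙 p? ≡ 1
𝟙-yes (yes _) p = refl
𝟙-yes (no ¬p) p = contradiction p ¬p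

𝟙-×-dec : {P Q : Set} (p? : Dec P) (q? : Dec Q) → 𝟙 (p? ×-dec q?) ≡ 𝟙 p? * 𝟙 q?
𝟙-×-dec (yes _) (yes _) = refl
𝟙-×-dec (yes _) (no _)  = refl
𝟙-×-dec (no _)  _       = refl

n≤1⇒n*n≡n : ∀ {n} → n ≤ 1 → n * n ≡ n
n≤1⇒n*n≡n z≤n       = refl
n≤1⇒n*n≡n (s≤s z≤n) = refl

∑-𝟙-< : ∀ m a → ∑ (downFrom m) (λ c → 𝟙 (c <? a)) ≡ a ⊓ m
∑-𝟙-< zero    a = sym (⊓-zeroʳ a)
∑-𝟙-< (suc m) a with m <? a
... | yes m<a = trans (cong suc (trans (∑-𝟙-< m a) (m≥n⇒m⊓n≡n (<⇒≤ m<a)))) (sym (m≥n⇒m⊓n≡n m<a))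
... | no  m≮a = trans (∑-𝟙-< m a) (trans (m≤n⇒m⊓n≡m a≤m) (sym (m≤n⇒m⊓n≡m (m≤n⇒m≤1+n a≤m))))
  where a≤m = ≮⇒≥ m≮a

-- Intervals and boxes of lattice points

Interval : Set
Interval = ℕ × ℕ

infix 4 _∈ᴵ_ _∈ᴵ?_

_∈ᴵ_ : ℕ → Interval → Set
c ∈ᴵ (lo , hi) = lo ≤ c × c < hi

_∈ᴵ?_ : ∀ c I → Dec (c ∈ᴵ I)
c ∈ᴵ? (lo , hi) = lo ≤? c ×-dec c <? hi

width : Interval → ℕ
width (lo , hi) = hi ∸ lo

𝟙-<-split : ∀ {lo hi} c → lo ≤ hi → 𝟙 (c <? lo) + 𝟙 (c ∈ᴵ? (lo , hi)) ≡ 𝟙 (c <? hi)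
𝟙-<-split {lo} {hi} c lo≤hi with c <? lo | lo ≤? c
... | yes c<lo | yes lo≤c = contradiction c<lo (≤⇒≯ lo≤c)
... | yes c<lo | no  _    = sym (𝟙-yes (c <? hi) (<-≤-trans c<lo lo≤hi))
... | no  _    | yes lo≤c = trans (𝟙-×-dec (yes lo≤c) (c <? hi)) (*-identityˡ _)
... | no  c≮lo | no  lo≰c = contradiction (≮⇒≥ c≮lo) lo≰c

∑-𝟙-∈ᴵ : ∀ m {lo hi} → lo ≤ hi → hi ≤ m → ∑ (downFrom m) (λ c → 𝟙 (c ∈ᴵ? (lo , hi))) ≡ hi ∸ lo
∑-𝟙-∈ᴵ m {lo} {hi} lo≤hi hi≤m = begin
  S                                                            ≡⟨ m+n∸m≡n (∑ cs (λ c → 𝟙 (c <? lo))) S ⟨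
  ∑ cs (λ c → 𝟙 (c <? lo)) + S ∸ ∑ cs (λ c → 𝟙 (c <? lo))       ≡⟨ cong₂ _∸_ split (∑-𝟙-< m lo) ⟩
  ∑ cs (λ c → 𝟙 (c <? hi)) ∸ lo ⊓ m
    ≡⟨ cong₂ _∸_ (∑-𝟙-< m hi) (m≤n⇒m⊓n≡m (≤-trans lo≤hi hi≤m)) ⟩
  hi ⊓ m ∸ lo                                                  ≡⟨ cong (_∸ lo) (m≤n⇒m⊓n≡m hi≤m) ⟩
  hi ∸ lo                                                      ∎
  where
  open ≡-Reasoning
  cs = downFrom m
  S = ∑ cs (λ c → 𝟙 (c ∈ᴵ? (lo , hi)))
  split : ∑ cs (λ c → 𝟙 (c <? lo)) + S ≡ ∑ cs (λ c → 𝟙 (c <? hi))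
  split = trans (sym (∑-+ cs _ _)) (∑-cong cs (λ {c} _ → 𝟙-<-split c lo≤hi))

IntervalsMeet : Interval → Interval → Set
IntervalsMeet (lo , hi) (lo′ , hi′) = lo < hi′ × lo′ < hi

intervalsMeet? : ∀ I J → Dec (IntervalsMeet I J)
intervalsMeet? (lo , hi) (lo′ , hi′) = lo <? hi′ ×-dec lo′ <? hi

∈ᴵ-both⇒meet : ∀ {c} I J → c ∈ᴵ I → c ∈ᴵ J → IntervalsMeet I J
∈ᴵ-both⇒meet I J (lo≤c , c<hi) (lo′≤c , c<hi′) = ≤-<-trans lo≤c c<hi′ , ≤-<-trans lo′≤c c<hi

meet⇒⊔∈ᴵ : ∀ {lo hi lo′ hi′} → lo < hi → lo′ < hi′ → IntervalsMeet (lo , hi) (lo′ , hi′) →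
           lo ⊔ lo′ ∈ᴵ (lo , hi) × lo ⊔ lo′ ∈ᴵ (lo′ , hi′)
meet⇒⊔∈ᴵ lo<hi lo′<hi′ (lo<hi′ , lo′<hi) =
  (m≤m⊔n _ _ , ⊔-lub lo<hi lo′<hi) , (m≤n⊔m _ _ , ⊔-lub lo<hi′ lo′<hi′)

intersectionSize : ℕ → Interval → Interval → ℕ
intersectionSize m I J = ∑ (downFrom m) (λ c → 𝟙 (c ∈ᴵ? I) * 𝟙 (c ∈ᴵ? J))

intersectionSize≤width : ∀ m {lo hi} J → lo ≤ hi → hi ≤ m → intersectionSize m (lo , hi) J ≤ hi ∸ lo
intersectionSize≤width m {lo} {hi} J lo≤hi hi≤m = begin
  intersectionSize m (lo , hi) J
    ≤⟨ ∑-mono (downFrom m) (λ {c} _ → *-monoʳ-≤ (𝟙 (c ∈ᴵ? (lo , hi))) (𝟙≤1 (c ∈ᴵ? J))) ⟩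
  ∑ (downFrom m) (λ c → 𝟙 (c ∈ᴵ? (lo , hi)) * 1) ≡⟨ ∑-cong (downFrom m) (λ _ → *-identityʳ _) ⟩
  ∑ (downFrom m) (λ c → 𝟙 (c ∈ᴵ? (lo , hi)))     ≡⟨ ∑-𝟙-∈ᴵ m lo≤hi hi≤m ⟩
  hi ∸ lo                                        ∎
  where open ≤-Reasoning

intersectionSize-comm : ∀ m I J → intersectionSize m I J ≡ intersectionSize m J I
intersectionSize-comm m I J = ∑-cong (downFrom m) (λ {c} _ → *-comm (𝟙 (c ∈ᴵ? I)) (𝟙 (c ∈ᴵ? J)))

intersectionSize-disjoint : ∀ m I J → ¬ IntervalsMeet I J → intersectionSize m I J ≡ 0
intersectionSize-disjoint m I J ∦ = trans (∑-cong (downFrom m) vanish) (∑-const (downFrom m) 0)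
  where
  vanish : ∀ {c} → c ∈ downFrom m → 𝟙 (c ∈ᴵ? I) * 𝟙 (c ∈ᴵ? J) ≡ 0
  vanish {c} _ with c ∈ᴵ? I | c ∈ᴵ? J
  ... | yes c∈I | yes c∈J = contradiction (∈ᴵ-both⇒meet I J c∈I c∈J) ∦
  ... | yes _   | no _    = refl
  ... | no _    | _       = refl

cells : Vec ℕ d → List (Vec ℕ d)
cells []       = [] ∷ []
cells (b ∷ bs) = cartesianProductWith _∷_ (downFrom b) (cells bs)

∈-cells⁺ : ∀ (bs : Vec ℕ d) {x} → (∀ i → lookup x i < lookup bs i) → x ∈ cells bs
∈-cells⁺ []       {[]}    _  = here refl
∈-cells⁺ (b ∷ bs) {c ∷ x} x< = ∈-cartesianProductWith⁺ _∷_ (∈-downFrom⁺ (x< zero)) (∈-cells⁺ bs (λ i → x< (suc i)))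

∈-cells⁻ : ∀ (bs : Vec ℕ d) {x} → x ∈ cells bs → ∀ i → lookup x i < lookup bs i
∈-cells⁻ (b ∷ bs) x∈ i with ∈-cartesianProductWith⁻ _∷_ (downFrom b) (cells bs) x∈
∈-cells⁻ (b ∷ bs) x∈ zero    | c , x , c∈ , x∈′ , refl = ∈-downFrom⁻ c∈
∈-cells⁻ (b ∷ bs) x∈ (suc i) | c , x , c∈ , x∈′ , refl = ∈-cells⁻ bs x∈′ i

length-cells-∷ : ∀ b (bs : Vec ℕ d) → length (cells (b ∷ bs)) ≡ b * length (cells bs)
length-cells-∷ b bs = trans (length-cartesianProductWith _∷_ (downFrom b) (cells bs)) (cong (_* _) (length-downFrom b))

Box : ℕ → Set
Box d = Vec Interval d

χ : Box d → Vec ℕ d → ℕ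
χ []      []      = 1
χ (I ∷ B) (c ∷ x) = 𝟙 (c ∈ᴵ? I) * χ B x

BoxesMeet : Box d → Box d → Set
BoxesMeet = Pointwise IntervalsMeet

boxesMeet? : (B B′ : Box d) → Dec (BoxesMeet B B′)
boxesMeet? = Pointwise.decidable intervalsMeet?

grid : (d m : ℕ) → List (Vec ℕ d)
grid d m = cells (V.replicate d m)

length-grid : ∀ d m → length (grid d m) ≡ m ^ d
length-grid zero    m = refl
length-grid (suc d) m = trans (length-cells-∷ m (V.replicate d m)) (cong (m *_) (length-grid d m))

boxIntersectionSize : ℕ → Box d → Box d → ℕ
boxIntersectionSize m []      []        = 1
boxIntersectionSize m (I ∷ B) (J ∷ B′) = intersectionSize m I J * boxIntersectionSize m B B′

∑-grid-χ*χ : ∀ m (B B′ : Box d) → ∑ (grid d m) (λ x → χ B x * χ B′ x) ≡ boxIntersectionSize m B B′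
∑-grid-χ*χ m []      []        = refl
∑-grid-χ*χ m (I ∷ B) (J ∷ B′) = begin
  ∑ (cartesianProductWith _∷_ cs G) (λ x → χ (I ∷ B) x * χ (J ∷ B′) x)
    ≡⟨ ∑-cartesianProductWith _∷_ cs G _ ⟩
  ∑ cs (λ c → ∑ G (λ x → (𝟙 (c ∈ᴵ? I) * χ B x) * (𝟙 (c ∈ᴵ? J) * χ B′ x)))
    ≡⟨ ∑-cong cs (λ {c} _ → ∑-cong G (λ {x} _ → *-interchange (𝟙 (c ∈ᴵ? I)) (χ B x) _ _)) ⟩
  ∑ cs (λ c → ∑ G (λ x → (𝟙 (c ∈ᴵ? I) * 𝟙 (c ∈ᴵ? J)) * (χ B x * χ B′ x)))
    ≡⟨ ∑-cong cs (λ {c} _ → ∑-*ˡ G (𝟙 (c ∈ᴵ? I) * 𝟙 (c ∈ᴵ? J)) _) ⟩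
  ∑ cs (λ c → (𝟙 (c ∈ᴵ? I) * 𝟙 (c ∈ᴵ? J)) * ∑ G (λ x → χ B x * χ B′ x))
    ≡⟨ ∑-*ʳ cs _ (λ c → 𝟙 (c ∈ᴵ? I) * 𝟙 (c ∈ᴵ? J)) ⟩
  intersectionSize m I J * ∑ G (λ x → χ B x * χ B′ x)
    ≡⟨ cong (intersectionSize m I J *_) (∑-grid-χ*χ m B B′) ⟩
  boxIntersectionSize m (I ∷ B) (J ∷ B′) ∎
  where
  open ≡-Reasoning
  cs = downFrom m
  G = grid _ m

boxIntersectionSize-disjoint : ∀ m (B B′ : Box d) → ¬ BoxesMeet B B′ → boxIntersectionSize m B B′ ≡ 0
boxIntersectionSize-disjoint m []      []        ∦ = contradiction [] ∦
boxIntersectionSize-disjoint m (I ∷ B) (J ∷ B′) ∦ with intervalsMeet? I J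
... | no  I∦J = cong (_* boxIntersectionSize m B B′) (intersectionSize-disjoint m I J I∦J)
... | yes I∥J = trans (cong (intersectionSize m I J *_) (boxIntersectionSize-disjoint m B B′ (∦ ∘′ (I∥J ∷_))))
                      (*-zeroʳ (intersectionSize m I J))

χ≤1 : (B : Box d) (x : Vec ℕ d) → χ B x ≤ 1
χ≤1 []      []      = ≤-refl
χ≤1 (I ∷ B) (c ∷ x) = *-mono-≤ (𝟙≤1 (c ∈ᴵ? I)) (χ≤1 B x)

Within : ℕ → Interval → Set
Within m (lo , hi) = lo ≤ hi × hi ≤ m

volume : Box d → ℕ
volume []      = 1
volume (I ∷ B) = width I * volume B

∑-grid-χ : ∀ m (B : Box d) → VecAll.All (Within m) B → ∑ (grid d m) (χ B) ≡ volume B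
∑-grid-χ m B within = begin
  ∑ (grid _ m) (χ B)                    ≡⟨ ∑-cong (grid _ m) (λ {x} _ → n≤1⇒n*n≡n (χ≤1 B x)) ⟨
  ∑ (grid _ m) (λ x → χ B x * χ B x)    ≡⟨ ∑-grid-χ*χ m B B ⟩
  boxIntersectionSize m B B             ≡⟨ diagonal B within ⟩
  volume B                              ∎
  where
  open ≡-Reasoning
  diagonal : ∀ {d} (B : Box d) → VecAll.All (Within m) B → boxIntersectionSize m B B ≡ volume B
  diagonal []              []                     = refl
  diagonal ((lo , hi) ∷ B) ((lo≤hi , hi≤m) ∷ wB) = cong₂ _*_ side (diagonal B wB)
    where
    side : intersectionSize m (lo , hi) (lo , hi) ≡ hi ∸ lo
    side = trans (∑-cong (downFrom m) (λ {c} _ → n≤1⇒n*n≡n (𝟙≤1 (c ∈ᴵ? (lo , hi)))))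
                 (∑-𝟙-∈ᴵ m lo≤hi hi≤m)

lookup≤sum : ∀ {d} (t : Vec ℕ d) i → lookup t i ≤ V.sum t
lookup≤sum (a ∷ t) zero    = m≤m+n a (V.sum t)
lookup≤sum (a ∷ t) (suc i) = ≤-trans (lookup≤sum t i) (m≤n+m (V.sum t) a)

sum-∸-complement : ∀ k {n} (t : Vec ℕ n) → (∀ i → lookup t i ≤ k) → V.sum (V.map (k ∸_) t) + V.sum t ≡ n * k
sum-∸-complement k []      _   = refl
sum-∸-complement k {suc n} (a ∷ t) t≤k = begin
  k ∸ a + V.sum (V.map (k ∸_) t) + (a + V.sum t) ≡⟨ +-interchange (k ∸ a) _ a _ ⟩
  k ∸ a + a + (V.sum (V.map (k ∸_) t) + V.sum t)
    ≡⟨ cong₂ _+_ (m∸n+n≡m (t≤k zero)) (sum-∸-complement k t (λ i → t≤k (suc i))) ⟩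
  k + n * k                                     ∎
  where
  open ≡-Reasoning

sum-⊓≤ˡ : (t u : Vec ℕ d) → V.sum (V.zipWith _⊓_ t u) ≤ V.sum t
sum-⊓≤ˡ []      []      = z≤n
sum-⊓≤ˡ (a ∷ t) (b ∷ u) = +-mono-≤ (m⊓n≤m a b) (sum-⊓≤ˡ t u)

sum-⊓≤ʳ : (t u : Vec ℕ d) → V.sum (V.zipWith _⊓_ t u) ≤ V.sum u
sum-⊓≤ʳ []      []      = z≤n
sum-⊓≤ʳ (a ∷ t) (b ∷ u) = +-mono-≤ (m⊓n≤n a b) (sum-⊓≤ʳ t u)

sum-⊓< : (t u : Vec ℕ d) → V.sum t ≡ V.sum u → t ≢ u → V.sum (V.zipWith _⊓_ t u) < V.sum t
sum-⊓< []      []      _  t≢u = contradiction refl t≢u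
sum-⊓< (a ∷ t) (b ∷ u) eq t≢u with <-cmp a b
... | tri< a<b _ _ = +-mono-≤-< (m⊓n≤m a b) (≤-<-trans (sum-⊓≤ʳ t u) Σu<Σt)
  where
  Σu<Σt : V.sum u < V.sum t
  Σu<Σt = ≰⇒> (λ Σt≤Σu → <⇒≢ (+-mono-<-≤ a<b Σt≤Σu) eq)
... | tri≈ _ refl _ = +-mono-≤-< (m⊓n≤m a a) (sum-⊓< t u (+-cancelˡ-≡ a _ _ eq) (t≢u ∘′ cong (a ∷_)))
... | tri> _ _ b<a = +-mono-<-≤ (≤-<-trans (m⊓n≤n a b) b<a) (sum-⊓≤ˡ t u)

_≟ᴮ_ : ∀ {d} → DecidableEquality (Block d)
_≟ᴮ_ = ×-≡-dec (≡-dec _≟_) (≡-dec _≟_)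

box : ℕ → Block d → Box d
box s (t , p) = V.zipWith (λ a q → s ^ a * q , s ^ a * suc q) t p

module _ (s : ℕ) where

  width-block : ∀ a q → s ^ a * suc q ∸ s ^ a * q ≡ s ^ a
  width-block a q = trans (cong (_∸ s ^ a * q) (*-suc (s ^ a) q)) (m+n∸n≡m (s ^ a) (s ^ a * q))

  volume-box : (t p : Vec ℕ d) → volume (box s (t , p)) ≡ s ^ V.sum t
  volume-box []      []      = refl
  volume-box (a ∷ t) (q ∷ p) =
    trans (cong₂ _*_ (width-block a q) (volume-box t p)) (sym (^-distribˡ-+-* s a (V.sum t)))

  box-within : ∀ k (t p : Vec ℕ d) → (∀ i → lookup t i ≤ k) → (∀ i → lookup p i < s ^ (k ∸ lookup t i)) →
               VecAll.All (Within (s ^ k)) (box s (t , p))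
  box-within k []      []      t≤k p< = []
  box-within k (a ∷ t) (q ∷ p) t≤k p< =
    (*-monoʳ-≤ (s ^ a) (n≤1+n q) , hi≤) ∷ box-within k t p (λ i → t≤k (suc i)) (λ i → p< (suc i))
    where
    hi≤ : s ^ a * suc q ≤ s ^ k
    hi≤ = begin
      s ^ a * suc q         ≤⟨ *-monoʳ-≤ (s ^ a) (p< zero) ⟩
      s ^ a * s ^ (k ∸ a)   ≡⟨ ^-distribˡ-+-* s a (k ∸ a) ⟨
      s ^ (a + (k ∸ a))     ≡⟨ cong (s ^_) (m+[n∸m]≡n (t≤k zero)) ⟩
      s ^ k                 ∎
      where open ≤-Reasoning

  aligned-disjoint : ∀ a {q q′} → q ≢ q′ → ¬ IntervalsMeet (s ^ a * q , s ^ a * suc q) (s ^ a * q′ , s ^ a * suc q′)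
  aligned-disjoint a {q} {q′} q≢q′ (lo<hi′ , lo′<hi) with <-cmp q q′
  ... | tri< q<q′ _ _ = ≤⇒≯ (*-monoʳ-≤ (s ^ a) q<q′) lo′<hi
  ... | tri≈ _ q≡q′ _ = q≢q′ q≡q′
  ... | tri> _ _ q′<q = ≤⇒≯ (*-monoʳ-≤ (s ^ a) q′<q) lo<hi′

  sameScale-disjoint : (t p q : Vec ℕ d) → p ≢ q → ¬ BoxesMeet (box s (t , p)) (box s (t , q))
  sameScale-disjoint []      []      []        p≢q _ = p≢q refl
  sameScale-disjoint (a ∷ t) (x ∷ p) (y ∷ q) p≢q (meet ∷ meets) with x ≟ y
  ... | yes refl = sameScale-disjoint t p q (p≢q ∘′ cong (x ∷_)) meets
  ... | no  x≢y  = aligned-disjoint a x≢y meet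

  blockIntersectionSize≤ : ∀ m (t p u q : Vec ℕ d) →
    VecAll.All (Within m) (box s (t , p)) → VecAll.All (Within m) (box s (u , q)) →
    boxIntersectionSize m (box s (t , p)) (box s (u , q)) ≤ s ^ V.sum (V.zipWith _⊓_ t u)
  blockIntersectionSize≤ m []      []      []      []      _        _        = ≤-refl
  blockIntersectionSize≤ m (a ∷ t) (x ∷ p) (b ∷ u) (y ∷ q) (wI ∷ wB) (wJ ∷ wB′) = begin
    intersectionSize m I J * boxIntersectionSize m (box s (t , p)) (box s (u , q))
      ≤⟨ *-mono-≤ coordinate (blockIntersectionSize≤ m t p u q wB wB′) ⟩
    s ^ (a ⊓ b) * s ^ V.sum (V.zipWith _⊓_ t u)
      ≡⟨ ^-distribˡ-+-* s (a ⊓ b) _ ⟨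
    s ^ (a ⊓ b + V.sum (V.zipWith _⊓_ t u)) ∎
    where
    open ≤-Reasoning
    I = (s ^ a * x , s ^ a * suc x)
    J = (s ^ b * y , s ^ b * suc y)
    coordinate : intersectionSize m I J ≤ s ^ (a ⊓ b)
    coordinate with ≤-total a b
    ... | inj₁ a≤b = begin
      intersectionSize m I J ≤⟨ intersectionSize≤width m J (proj₁ wI) (proj₂ wI) ⟩
      s ^ a * suc x ∸ s ^ a * x ≡⟨ width-block a x ⟩
      s ^ a                     ≡⟨ cong (s ^_) (m≤n⇒m⊓n≡m a≤b) ⟨
      s ^ (a ⊓ b)               ∎
    ... | inj₂ b≤a = begin
      intersectionSize m I J ≡⟨ intersectionSize-comm m I J ⟩
      intersectionSize m J I ≤⟨ intersectionSize≤width m I (proj₁ wJ) (proj₂ wJ) ⟩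
      s ^ b * suc y ∸ s ^ b * y ≡⟨ width-block b y ⟩
      s ^ b                     ≡⟨ cong (s ^_) (m≥n⇒m⊓n≡n b≤a) ⟨
      s ^ (a ⊓ b)               ∎

  module _ .{{_ : NonZero s}} where

    block-nonempty : ∀ a q → s ^ a * q < s ^ a * suc q
    block-nonempty a q = *-monoʳ-< (s ^ a) {{m^n≢0 s a}} (n<1+n q)

    meet⇒intersect : (t p u q : Vec ℕ d) → BoxesMeet (box s (t , p)) (box s (u , q)) → Intersect d s (t , p) (u , q)
    meet⇒intersect []      []      []      []      _              = [] , (λ ()) , (λ ())
    meet⇒intersect (a ∷ t) (x ∷ p) (b ∷ u) (y ∷ q) (meet ∷ meets) =
      c ∷ z , (λ { zero → proj₁ c∈ ; (suc i) → z∈B i }) , (λ { zero → proj₂ c∈ ; (suc i) → z∈B′ i })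
      where
      c  = s ^ a * x ⊔ s ^ b * y
      c∈ = meet⇒⊔∈ᴵ (block-nonempty a x) (block-nonempty b y) meet
      rest = meet⇒intersect t p u q meets
      z = proj₁ rest
      z∈B = proj₁ (proj₂ rest)
      z∈B′ = proj₂ (proj₂ rest)

    -- Distinct blocks with the same scale vector are disjoint. Otherwise the scale vectors
    -- differ but have the same sum, so the coordinatewise minimum has a smaller sum and the
    -- intersection has at most s^(k-1) points.
    s*blockIntersectionSize≤ : ∀ k (t p u q : Vec ℕ d) → V.sum t ≡ k → V.sum u ≡ k →
      VecAll.All (Within (s ^ k)) (box s (t , p)) → VecAll.All (Within (s ^ k)) (box s (u , q)) → (t , p) ≢ (u , q) →
      s * boxIntersectionSize (s ^ k) (box s (t , p)) (box s (u , q)) ≤ s ^ k * 𝟙 (boxesMeet? (box s (t , p)) (box s (u , q)))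
    s*blockIntersectionSize≤ k t p u q Σt Σu wB wB′ b≢b′ with boxesMeet? (box s (t , p)) (box s (u , q))
    ... | no ∦ = begin
      s * boxIntersectionSize (s ^ k) (box s (t , p)) (box s (u , q)) ≡⟨ cong (s *_) (boxIntersectionSize-disjoint _ _ _ ∦) ⟩
      s * 0                                                           ≡⟨ *-zeroʳ s ⟩
      0                                                               ≤⟨ z≤n ⟩
      s ^ k * 0                                                       ∎
      where open ≤-Reasoning
    ... | yes meet with ≡-dec _≟_ t u
    ...   | yes refl = contradiction meet (sameScale-disjoint t p q (b≢b′ ∘′ cong (t ,_)))
    ...   | no  t≢u  = begin
      s * boxIntersectionSize (s ^ k) (box s (t , p)) (box s (u , q))
        ≤⟨ *-monoʳ-≤ s (blockIntersectionSize≤ _ t p u q wB wB′) ⟩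
      s * s ^ V.sum (V.zipWith _⊓_ t u)                              ≤⟨ ^-monoʳ-≤ s (sum-⊓< t u (trans Σt (sym Σu)) t≢u) ⟩
      s ^ V.sum t                                                     ≡⟨ cong (s ^_) Σt ⟩
      s ^ k                                                           ≡⟨ *-identityʳ (s ^ k) ⟨
      s ^ k * 1                                                       ∎
      where open ≤-Reasoning


-- Graph containers

module Removal {A : Set} (_≟_ : DecidableEquality A) where

  infixl 5 _∖_

  _∖_ : List A → A → List A
  U ∖ v = filter (λ w → ¬? (v ≟ w)) U

  ∈-∖⁺ : ∀ {U v w} → w ∈ U → v ≢ w → w ∈ U ∖ v
  ∈-∖⁺ = ∈-filter⁺ _

  ∈-∖⁻ : ∀ {U v w} → w ∈ U ∖ v → w ∈ U × v ≢ w
  ∈-∖⁻ = ∈-filter⁻ _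

  ∖-⊆ : ∀ {U v} → U ∖ v ⊆ U
  ∖-⊆ w∈ = proj₁ (∈-∖⁻ w∈)

  ∖-! : ∀ {U} v → Unique U → Unique (U ∖ v)
  ∖-! v = Unique.filter⁺ _

  length-∖< : ∀ {U v} → v ∈ U → length (U ∖ v) < length U
  length-∖< {U} v∈U = filter-notAll _ U (Any.map (λ { refl v≢v → v≢v refl }) v∈U)

  ∑-∖ : ∀ {U} (f : A → ℕ) → Unique U → ∀ {v} → v ∈ U → ∑ U f ≡ f v + ∑ (U ∖ v) f
  ∑-∖ {v ∷ U} f (v∉U ∷ _) (here refl) =
    cong (λ xs → f v + ∑ xs f)
         (sym (trans (filter-reject (λ w → ¬? (v ≟ w)) (λ v≢v → v≢v refl)) (filter-all (λ w → ¬? (v ≟ w)) v∉U)))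
  ∑-∖ {x ∷ U} f (x∉U ∷ u) {v} (there v∈U) = begin
    f x + ∑ U f                ≡⟨ cong (f x +_) (∑-∖ f u v∈U) ⟩
    f x + (f v + ∑ (U ∖ v) f)  ≡⟨ x+[y+z]≡y+[x+z] (f x) (f v) _ ⟩
    f v + (f x + ∑ (U ∖ v) f)  ≡⟨ cong (λ xs → f v + ∑ xs f) (filter-accept (λ w → ¬? (v ≟ w)) v≢x) ⟨
    f v + ∑ ((x ∷ U) ∖ v) f   ∎
    where
    open ≡-Reasoning
    v≢x : v ≢ x
    v≢x v≡x = All.lookup x∉U v∈U (sym v≡x)

  module _ {P : Set} (points : List P) (χ : A → P → ℕ) (χ≤1 : ∀ a x → χ a x ≤ 1) where

    private
      multiplicity : List A → P → ℕ
      multiplicity U x = ∑ U (λ a → χ a x)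

      n≤1+n*[n∸1] : ∀ n → n ≤ 1 + n * (n ∸ 1)
      n≤1+n*[n∸1] zero    = z≤n
      n≤1+n*[n∸1] (suc n) = s≤s (≤-trans (m≤m*n n (suc n)) (≤-reflexive (*-comm n (suc n))))

      indicator-∸ : ∀ {a} c → a ≤ 1 → a * (c ∸ a) ≡ a * (c ∸ 1)
      indicator-∸ c z≤n       = refl
      indicator-∸ c (s≤s z≤n) = refl

      multiplicity≤ : ∀ {U} → Unique U → ∀ x → multiplicity U x ≤ 1 + ∑ U (λ a → χ a x * multiplicity (U ∖ a) x)
      multiplicity≤ {U} u x = begin
        c                                            ≤⟨ n≤1+n*[n∸1] c ⟩
        1 + c * (c ∸ 1)                              ≡⟨ cong (1 +_) (∑-*ʳ U (c ∸ 1) (λ a → χ a x)) ⟨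
        1 + ∑ U (λ a → χ a x * (c ∸ 1))              ≡⟨ cong (1 +_) (∑-cong U others) ⟨
        1 + ∑ U (λ a → χ a x * multiplicity (U ∖ a) x) ∎
        where
        open ≤-Reasoning
        c = multiplicity U x
        others : ∀ {a} → a ∈ U → χ a x * multiplicity (U ∖ a) x ≡ χ a x * (c ∸ 1)
        others {a} a∈U = trans (cong (χ a x *_) rest) (indicator-∸ c (χ≤1 a x))
          where
          rest : multiplicity (U ∖ a) x ≡ c ∸ χ a x
          rest = trans (sym (m+n∸m≡n (χ a x) _)) (cong (_∸ χ a x) (sym (∑-∖ (λ b → χ b x) u a∈U)))

    -- A point covered c times satisfies c ≤ 1 + c (c - 1).
    overcount : ∀ {U} → Unique U →
      ∑ U (λ a → ∑ points (χ a))
        ≤ length points + ∑ U (λ a → ∑ (U ∖ a) (λ a′ → ∑ points (λ x → χ a x * χ a′ x)))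
    overcount {U} u = begin
      ∑ U (λ a → ∑ points (χ a))
        ≡⟨ ∑-swap U points χ ⟩
      ∑ points (multiplicity U)
        ≤⟨ ∑-mono points (λ {x} _ → multiplicity≤ u x) ⟩
      ∑ points (λ x → 1 + ∑ U (λ a → χ a x * multiplicity (U ∖ a) x))
        ≡⟨ ∑-+ points (λ _ → 1) _ ⟩
      ∑ points (λ _ → 1) + ∑ points (λ x → ∑ U (λ a → χ a x * multiplicity (U ∖ a) x))
        ≡⟨ cong₂ _+_ (trans (∑-const points 1) (*-identityˡ _)) (∑-swap points U _) ⟩
      length points + ∑ U (λ a → ∑ points (λ x → χ a x * multiplicity (U ∖ a) x))
        ≡⟨ cong (length points +_) (∑-cong U (λ {a} _ → pairs a)) ⟩
      length points + ∑ U (λ a → ∑ (U ∖ a) (λ a′ → ∑ points (λ x → χ a x * χ a′ x))) ∎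
      where
      open ≤-Reasoning
      pairs : ∀ a → ∑ points (λ x → χ a x * multiplicity (U ∖ a) x)
                    ≡ ∑ (U ∖ a) (λ a′ → ∑ points (λ x → χ a x * χ a′ x))
      pairs a = trans (∑-cong points (λ {x} _ → sym (∑-*ˡ (U ∖ a) (χ a x) (λ a′ → χ a′ x))))
                      (∑-swap points (U ∖ a) (λ x a′ → χ a x * χ a′ x))

words : ℕ → List A → List (List A)
words zero    U = [] ∷ []
words (suc q) U = [] ∷ cartesianProductWith _∷_ U (words q U)

∈-words⁺ : ∀ q {U F : List A} → F ⊆ U → length F ≤ q → F ∈ words q U
∈-words⁺ zero    {F = []}    _  _         = here refl
∈-words⁺ (suc q) {F = []}    _  _         = here refl
∈-words⁺ (suc q) {F = x ∷ F} F⊆ (s≤s |F|≤) =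
  there (∈-cartesianProductWith⁺ _∷_ (F⊆ (here refl)) (∈-words⁺ q (F⊆ ∘ there) |F|≤))

∈-words⁻ : ∀ q {U F : List A} → F ∈ words q U → F ⊆ U × length F ≤ q
∈-words⁻ zero    (here refl) = (λ ()) , z≤n
∈-words⁻ (suc q) (here refl) = (λ ()) , z≤n
∈-words⁻ (suc q) {U} (there F∈) with ∈-cartesianProductWith⁻ _∷_ U (words q U) F∈
... | x , F , x∈U , F∈′ , refl =
  (λ { (here refl) → x∈U ; (there y∈) → proj₁ (∈-words⁻ q F∈′) y∈ }) , s≤s (proj₂ (∈-words⁻ q F∈′))

length-words : ∀ q (U : List A) → length (words q U) ≤ suc (length U) ^ q
length-words zero    U = ≤-refl
length-words (suc q) U = begin
  suc (length (cartesianProductWith _∷_ U (words q U))) ≡⟨ cong suc (length-cartesianProductWith _∷_ U (words q U)) ⟩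
  suc (n * length (words q U))                          ≤⟨ s≤s (*-monoʳ-≤ n (length-words q U)) ⟩
  suc (n * suc n ^ q)                                   ≤⟨ +-monoˡ-≤ (n * suc n ^ q) (m^n>0 (suc n) q) ⟩
  suc n ^ q + n * suc n ^ q                             ∎
  where
  open ≤-Reasoning
  n = length U

module Containers {A : Set} (_≟_ : DecidableEquality A)
                  {Meets : A → A → Set} (meets? : ∀ v w → Dec (Meets v w)) (s : ℕ) where

  open import Data.List.Membership.DecPropositional _≟_ using (_∈?_)
  open Removal _≟_

  deg : List A → A → ℕ
  deg U v = ∑ (U ∖ v) (λ w → 𝟙 (meets? v w))

  nonNeighbours : A → List A → List A
  nonNeighbours v = filter (λ w → ¬? (meets? v w))

  length-nonNeighbours : ∀ v U → length (nonNeighbours v U) + ∑ U (λ w → 𝟙 (meets? v w)) ≡ length U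
  length-nonNeighbours v []      = refl
  length-nonNeighbours v (w ∷ U) with meets? v w
  ... | yes _ = trans (+-suc _ _) (cong suc (length-nonNeighbours v U))
  ... | no  _ = cong suc (length-nonNeighbours v U)

  farFrom : A → List A → List A
  farFrom v U = nonNeighbours v (U ∖ v)

  length-farFrom : ∀ v U → length (farFrom v U) + deg U v ≡ length (U ∖ v)
  length-farFrom v U = length-nonNeighbours v (U ∖ v)

  length-farFrom< : ∀ {v U} → v ∈ U → length (farFrom v U) < length U
  length-farFrom< {v} {U} v∈U = ≤-<-trans (≤-trans (m≤m+n _ (deg U v)) (≤-reflexive (length-farFrom v U))) (length-∖< v∈U)

  farFrom-⊆ : ∀ {v U} → farFrom v U ⊆ U
  farFrom-⊆ w∈ = ∖-⊆ (proj₁ (∈-filter⁻ _ w∈))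

  farFrom-! : ∀ {v U} → Unique U → Unique (farFrom v U)
  farFrom-! {v} u = Unique.filter⁺ _ (∖-! v u)

  IsIndependent : List A → Set
  IsIndependent I = ∀ {v w} → v ∈ I → w ∈ I → v ≢ w → ¬ Meets v w

  Sparse : List A → ℕ → Set
  Sparse U₀ L = ∀ {U} → Unique U → U ⊆ U₀ → All (λ v → 2 * deg U v < s) U → length U ≤ L

  -- Kleitman–Winston: while the remaining set U has a vertex v of degree ≥ s/2, if v ∈ I it
  -- joins the fingerprint and v and its neighbours leave U, otherwise only v leaves U. The
  -- first argument is fuel; length U suffices, since every step removes v.
  mutual
    run : ℕ → List A → List A → List A × List A
    run zero    I U = [] , U
    run (suc n) I U with any? (λ v → s ≤? 2 * deg U v) U
    ... | no  _    = [] , U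
    ... | yes high = branch n I U (proj₁ (find high))

    branch : ℕ → List A → List A → A → List A × List A
    branch n I U v with v ∈? I
    ... | yes _ = v ∷ proj₁ (run n I (farFrom v U)) , proj₂ (run n I (farFrom v U))
    ... | no  _ = run n I (U ∖ v)

  mutual
    run-count : ∀ n I U → s * length (proj₁ (run n I U)) + 2 * length (proj₂ (run n I U)) ≤ 2 * length U
    run-count zero    I U = ≤-reflexive (cong (_+ 2 * length U) (*-zeroʳ s))
    run-count (suc n) I U with any? (λ v → s ≤? 2 * deg U v) U
    ... | no  _    = ≤-reflexive (cong (_+ 2 * length U) (*-zeroʳ s))
    ... | yes high = let (v , v∈U , s≤2deg) = find high in branch-count n I U v∈U s≤2deg

    branch-count : ∀ n I U {v} → v ∈ U → s ≤ 2 * deg U v →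
      s * length (proj₁ (branch n I U v)) + 2 * length (proj₂ (branch n I U v)) ≤ 2 * length U
    branch-count n I U {v} v∈U s≤2deg with v ∈? I
    ... | no  _ = ≤-trans (run-count n I (U ∖ v)) (*-monoʳ-≤ 2 (<⇒≤ (length-∖< v∈U)))
    ... | yes _ = begin
      s * suc a + 2 * b                 ≡⟨ trans (cong (_+ 2 * b) (*-suc s a)) (+-assoc s (s * a) (2 * b)) ⟩
      s + (s * a + 2 * b)               ≤⟨ +-mono-≤ s≤2deg (run-count n I (farFrom v U)) ⟩
      2 * deg U v + 2 * length (farFrom v U)
        ≡⟨ trans (sym (*-distribˡ-+ 2 (deg U v) _)) (cong (2 *_) (+-comm (deg U v) (length (farFrom v U)))) ⟩
      2 * (length (farFrom v U) + deg U v)  ≡⟨ cong (2 *_) (length-farFrom v U) ⟩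
      2 * length (U ∖ v)                ≤⟨ *-monoʳ-≤ 2 (<⇒≤ (length-∖< v∈U)) ⟩
      2 * length U                      ∎
      where
      open ≤-Reasoning
      a = length (proj₁ (run n I (farFrom v U)))
      b = length (proj₂ (run n I (farFrom v U)))

  module _ {U₀ : List A} {L : ℕ} (sparse : Sparse U₀ L) where

    mutual
      run-small : ∀ n I U → Unique U → U ⊆ U₀ → length U ≤ n → length (proj₂ (run n I U)) ≤ L
      run-small zero    I []      _ _    _  = z≤n
      run-small (suc n) I U u U⊆ |U|≤ with any? (λ v → s ≤? 2 * deg U v) U
      ... | no  none = sparse u U⊆ (All.map ≰⇒> (All.¬Any⇒All¬ U none))
      ... | yes high = branch-small n I U (proj₁ (proj₂ (find high))) u U⊆ |U|≤

      branch-small : ∀ n I U {v} → v ∈ U → Unique U → U ⊆ U₀ → length U ≤ suc n → length (proj₂ (branch n I U v)) ≤ L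
      branch-small n I U {v} v∈U u U⊆ |U|≤ with v ∈? I
      ... | yes _ = run-small n I (farFrom v U) (farFrom-! u) (U⊆ ∘ farFrom-⊆) (≤-pred (<-≤-trans (length-farFrom< v∈U) |U|≤))
      ... | no  _ = run-small n I (U ∖ v) (∖-! v u) (U⊆ ∘ ∖-⊆) (≤-pred (<-≤-trans (length-∖< v∈U) |U|≤))

  mutual
    run-⊆ : ∀ n I U {x} → x ∈ proj₁ (run n I U) ⊎ x ∈ proj₂ (run n I U) → x ∈ U
    run-⊆ zero    I U (inj₂ x∈) = x∈
    run-⊆ (suc n) I U x∈ with any? (λ v → s ≤? 2 * deg U v) U
    run-⊆ (suc n) I U (inj₂ x∈) | no _ = x∈
    ... | yes high = branch-⊆ n I U (proj₁ (proj₂ (find high))) x∈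

    branch-⊆ : ∀ n I U {v} → v ∈ U → ∀ {x} → x ∈ proj₁ (branch n I U v) ⊎ x ∈ proj₂ (branch n I U v) → x ∈ U
    branch-⊆ n I U {v} v∈U x∈ with v ∈? I
    branch-⊆ n I U v∈U (inj₁ (here refl)) | yes _ = v∈U
    branch-⊆ n I U v∈U (inj₁ (there x∈))  | yes _ = farFrom-⊆ (run-⊆ n I _ (inj₁ x∈))
    branch-⊆ n I U v∈U (inj₂ x∈)          | yes _ = farFrom-⊆ (run-⊆ n I _ (inj₂ x∈))
    ... | no _ = ∖-⊆ (run-⊆ n I _ x∈)

  mutual
    fingerprint-⊆ : ∀ n I U → proj₁ (run n I U) ⊆ I
    fingerprint-⊆ zero    I U ()
    fingerprint-⊆ (suc n) I U x∈ with any? (λ v → s ≤? 2 * deg U v) U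
    fingerprint-⊆ (suc n) I U () | no _
    ... | yes high = branch-fingerprint-⊆ n I U (proj₁ (find high)) x∈

    branch-fingerprint-⊆ : ∀ n I U v → proj₁ (branch n I U v) ⊆ I
    branch-fingerprint-⊆ n I U v x∈ with v ∈? I
    branch-fingerprint-⊆ n I U v (here refl) | yes v∈I = v∈I
    branch-fingerprint-⊆ n I U v (there x∈)  | yes _   = fingerprint-⊆ n I _ x∈
    ... | no _ = fingerprint-⊆ n I _ x∈

  mutual
    run-cover : ∀ n I U → IsIndependent I → ∀ {b} → b ∈ I → b ∈ U → b ∈ proj₁ (run n I U) ⊎ b ∈ proj₂ (run n I U)
    run-cover zero    I U ind b∈I b∈U = inj₂ b∈U
    run-cover (suc n) I U ind b∈I b∈U with any? (λ v → s ≤? 2 * deg U v) U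
    ... | no  _    = inj₂ b∈U
    ... | yes high = branch-cover n I U (proj₁ (find high)) ind b∈I b∈U

    branch-cover : ∀ n I U v → IsIndependent I → ∀ {b} → b ∈ I → b ∈ U →
                   b ∈ proj₁ (branch n I U v) ⊎ b ∈ proj₂ (branch n I U v)
    branch-cover n I U v ind {b} b∈I b∈U with v ∈? I | v ≟ b
    ... | no v∉I | _       = run-cover n I (U ∖ v) ind b∈I (∈-∖⁺ b∈U (λ { refl → v∉I b∈I }))
    ... | yes _  | yes refl = inj₁ (here refl)
    ... | yes v∈I | no v≢b with meets? v b
    ...   | yes meet = contradiction meet (ind v∈I b∈I v≢b)
    ...   | no ∦ with run-cover n I (farFrom v U) ind b∈I (∈-filter⁺ _ (∈-∖⁺ b∈U v≢b) ∦)
    ...     | inj₁ b∈F = inj₁ (there b∈F)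
    ...     | inj₂ b∈R = inj₂ b∈R

  -- I is only queried at the vertices that enter the fingerprint.
  mutual
    run-determined : ∀ n W I U → proj₁ (run n I U) ⊆ W → W ⊆ I → run n W U ≡ run n I U
    run-determined zero    W I U F⊆W W⊆I = refl
    run-determined (suc n) W I U F⊆W W⊆I with any? (λ v → s ≤? 2 * deg U v) U
    ... | no  _    = refl
    ... | yes high = branch-determined n W I U (proj₁ (find high)) F⊆W W⊆I

    branch-determined : ∀ n W I U v → proj₁ (branch n I U v) ⊆ W → W ⊆ I → branch n W U v ≡ branch n I U v
    branch-determined n W I U v F⊆W W⊆I with v ∈? I | v ∈? W
    ... | yes _   | yes _   rewrite run-determined n W I (farFrom v U) (F⊆W ∘ there) W⊆I = refl
    ... | yes _   | no v∉W  = contradiction (F⊆W (here refl)) v∉W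
    ... | no  v∉I | yes v∈W = contradiction (W⊆I v∈W) v∉I
    ... | no  _   | no  _   = run-determined n W I (U ∖ v) F⊆W W⊆I

  container : List A → List A → List A
  container U₀ F = F ++ proj₂ (run (length U₀) F U₀)

  container-⊆ : ∀ {U₀ F} → F ⊆ U₀ → container U₀ F ⊆ U₀
  container-⊆ {U₀} {F} F⊆ x∈ with ∈-++⁻ F x∈
  ... | inj₁ x∈F = F⊆ x∈F
  ... | inj₂ x∈R = run-⊆ (length U₀) F U₀ (inj₂ x∈R)

  length-container : ∀ {U₀ L} → Sparse U₀ L → Unique U₀ → ∀ F → length (container U₀ F) ≤ length F + L
  length-container {U₀} sparse u F = ≤-trans (≤-reflexive (length-++ F))
    (+-monoʳ-≤ (length F) (run-small sparse (length U₀) F U₀ u (λ x∈ → x∈) ≤-refl))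

  fingerprint : ∀ {U₀ I} → IsIndependent I → I ⊆ U₀ →
    ∃[ F ] (F ⊆ U₀ × s * length F ≤ 2 * length U₀ × I ⊆ container U₀ F)
  fingerprint {U₀} {I} ind I⊆ = F , F⊆U₀ , ≤-trans (m≤m+n _ _) (run-count n I U₀) , I⊆container
    where
    n = length U₀
    F = proj₁ (run n I U₀)
    F⊆U₀ : F ⊆ U₀
    F⊆U₀ x∈ = run-⊆ n I U₀ (inj₁ x∈)
    same-run : run n F U₀ ≡ run n I U₀
    same-run = run-determined n F I U₀ (λ x∈ → x∈) (fingerprint-⊆ n I U₀)
    I⊆container : I ⊆ container U₀ F
    I⊆container {b} b∈I with run-cover n I U₀ ind b∈I (I⊆ b∈I)
    ... | inj₁ b∈F = ∈-++⁺ˡ b∈F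
    ... | inj₂ b∈R = ∈-++⁺ʳ F (subst (λ r → b ∈ proj₂ r) (sym same-run) b∈R)

  overlap-bound⇒sparse : ∀ {U₀ M} → (∀ {U} → Unique U → U ⊆ U₀ → s * length U ≤ s * M + ∑ U (deg U)) →
                         Sparse U₀ (2 * M)
  overlap-bound⇒sparse {M = M} bound {U} u U⊆ low = *-cancelˡ-≤ (suc s) (begin
    suc s * L                    ≡⟨ +-comm L (s * L) ⟩
    s * L + L                    ≤⟨ +-cancelˡ-≤ (s * L) _ _ twice ⟩
    2 * (s * M)                  ≤⟨ *-monoʳ-≤ 2 (*-monoˡ-≤ M (n≤1+n s)) ⟩
    2 * (suc s * M)              ≡⟨ x*[y*z]≡y*[x*z] 2 (suc s) M ⟩
    suc s * (2 * M)              ∎)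
    where
    open ≤-Reasoning
    L = length U
    D = ∑ U (deg U)
    low-sum : 2 * D + L ≤ s * L
    low-sum = begin
      2 * D + L                              ≡⟨ cong₂ _+_ (∑-*ˡ U 2 (deg U)) (trans (∑-const U 1) (*-identityˡ L)) ⟨
      ∑ U (λ v → 2 * deg U v) + ∑ U (λ _ → 1) ≡⟨ ∑-+ U _ _ ⟨
      ∑ U (λ v → 2 * deg U v + 1)            ≤⟨ ∑-mono U (λ v∈ → subst (_≤ s) (+-comm 1 _) (All.lookup low v∈)) ⟩
      ∑ U (λ _ → s)                          ≡⟨ ∑-const U s ⟩
      s * L                                  ∎
    regroup : ∀ a b → a + (a + b) ≡ 2 * a + b
    regroup = solve-∀
    twice : s * L + (s * L + L) ≤ s * L + 2 * (s * M)
    twice = begin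
      s * L + (s * L + L)      ≡⟨ regroup (s * L) L ⟩
      2 * (s * L) + L          ≤⟨ +-monoˡ-≤ L (*-monoʳ-≤ 2 (bound u U⊆)) ⟩
      2 * (s * M + D) + L      ≡⟨ trans (cong (_+ L) (*-distribˡ-+ 2 (s * M) D)) (+-assoc (2 * (s * M)) (2 * D) L) ⟩
      2 * (s * M) + (2 * D + L) ≤⟨ +-monoʳ-≤ (2 * (s * M)) low-sum ⟩
      2 * (s * M) + s * L      ≡⟨ +-comm (2 * (s * M)) (s * L) ⟩
      s * L + 2 * (s * M)      ∎

  module _ .{{_ : NonZero s}} where

    containers : ∀ {U₀ L} → Unique U₀ → Sparse U₀ L → ∃[ 𝓒 ]
      All (_⊆ U₀) 𝓒
      × All (λ C → length C ≤ 2 * length U₀ / s + L) 𝓒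
      × length 𝓒 ≤ suc (length U₀) ^ (2 * length U₀ / s)
      × (∀ {I} → IsIndependent I → I ⊆ U₀ → Any (I ⊆_) 𝓒)
    containers {U₀} {L} u sparse =
      map (container U₀) fingerprints ,
      All.map⁺ (All.tabulate (λ F∈ → container-⊆ (proj₁ (∈-words⁻ q F∈)))) ,
      All.map⁺ (All.tabulate (λ {F} F∈ → ≤-trans (length-container sparse u F) (+-monoˡ-≤ L (proj₂ (∈-words⁻ q F∈))))) ,
      ≤-trans (≤-reflexive (length-map (container U₀) fingerprints)) (length-words q U₀) ,
      covered
      where
      q = 2 * length U₀ / s
      fingerprints = words q U₀
      covered : ∀ {I} → IsIndependent I → I ⊆ U₀ → Any (I ⊆_) (map (container U₀) fingerprints)
      covered ind I⊆ with F , F⊆ , sF≤ , I⊆C ← fingerprint ind I⊆ =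
        Any.map⁺ (Any.map (λ { refl {x} → I⊆C {x} }) (∈-words⁺ q F⊆ |F|≤q))
        where
        |F|≤q : length F ≤ q
        |F|≤q = subst (_≤ q) (m*n/n≡m (length F) s) (/-monoˡ-≤ s (subst (_≤ 2 * length U₀) (*-comm s (length F)) sF≤))

-- The intersection graph of blocks

module BlockGraph (d s k : ℕ) .{{_ : NonZero s}} where

  m M : ℕ
  m = s ^ k
  M = m ^ (d ∸ 1)

  open Removal (_≟ᴮ_ {d})
  open Containers (_≟ᴮ_ {d}) (λ b b′ → boxesMeet? (box s b) (box s b′)) s public

  InT⇒≤ : ∀ t → InT d k t → ∀ i → lookup t i ≤ k
  InT⇒≤ t Σt i = subst (lookup t i ≤_) Σt (lookup≤sum t i)

  InB⇒within : ∀ {t p} → InB d s k (t , p) → VecAll.All (Within m) (box s (t , p))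
  InB⇒within {t} {p} (Σt , p<) = box-within s k t p (InT⇒≤ t Σt) p<

  overlap-bound : 1 ≤ d → ∀ {U} → Unique U → All (InB d s k) U → s * length U ≤ s * M + ∑ U (deg U)
  overlap-bound d≥1 {U} u valid = *-cancelˡ-≤ m {{m^n≢0 s k}} (begin
    m * (s * L)
      ≡⟨ x*[y*z]≡y*[x*z] m s L ⟩
    s * (m * L)
      ≡⟨ cong (s *_) (trans (sym (∑-const U m)) (∑-cong U (λ {b} b∈ → sym (volume-χ b (All.lookup valid b∈))))) ⟩
    s * ∑ U (λ b → ∑ G (χᵇ b))
      ≤⟨ *-monoʳ-≤ s (overcount G χᵇ (λ b → χ≤1 (box s b)) u) ⟩
    s * (length G + ∑ U (λ b → ∑ (U ∖ b) (pairSize b)))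
      ≡⟨ trans (*-distribˡ-+ s _ _) (cong (s * length G +_) (sym (∑-*ˡ² U s pairSize))) ⟩
    s * length G + ∑ U (λ b → ∑ (U ∖ b) (λ b′ → s * pairSize b b′))
      ≤⟨ +-monoʳ-≤ (s * length G) (∑-mono U (λ b∈ → ∑-mono (U ∖ _) (λ b′∈ → pair-bound b∈ b′∈))) ⟩
    s * length G + ∑ U (λ b → ∑ (U ∖ b) (λ b′ → m * 𝟙 (meets? b b′)))
      ≡⟨ cong₂ (λ x y → s * x + y) (trans (length-grid d m) (m^d d≥1)) (∑-*ˡ² U m (λ b b′ → 𝟙 (meets? b b′))) ⟩
    s * (m * M) + m * ∑ U (deg U)
      ≡⟨ cong (_+ m * ∑ U (deg U)) (x*[y*z]≡y*[x*z] s m M) ⟩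
    m * (s * M) + m * ∑ U (deg U)
      ≡⟨ *-distribˡ-+ m (s * M) _ ⟨
    m * (s * M + ∑ U (deg U)) ∎)
    where
    open ≤-Reasoning
    L = length U
    G = grid d m
    χᵇ : Block d → Vec ℕ d → ℕ
    χᵇ b = χ (box s b)
    pairSize : Block d → Block d → ℕ
    pairSize b b′ = ∑ G (λ x → χᵇ b x * χᵇ b′ x)
    meets? = λ b b′ → boxesMeet? (box s b) (box s b′)
    m^d : 1 ≤ d → m ^ d ≡ m * M
    m^d (s≤s _) = refl
    ∑-*ˡ² : ∀ V c (f : Block d → Block d → ℕ) →
            ∑ V (λ b → ∑ (V ∖ b) (λ b′ → c * f b b′)) ≡ c * ∑ V (λ b → ∑ (V ∖ b) (f b))
    ∑-*ˡ² V c f = trans (∑-cong V (λ {b} _ → ∑-*ˡ (V ∖ b) c _)) (∑-*ˡ V c _)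
    volume-χ : ∀ b → InB d s k b → ∑ G (χᵇ b) ≡ m
    volume-χ (t , p) valid@(Σt , _) = trans (∑-grid-χ m (box s (t , p)) (InB⇒within valid))
                                          (trans (volume-box s t p) (cong (s ^_) Σt))
    pair-bound : ∀ {b b′} → b ∈ U → b′ ∈ U ∖ b → s * pairSize b b′ ≤ m * 𝟙 (meets? b b′)
    pair-bound {t , p} {u , q} b∈ b′∈ with ∈-∖⁻ b′∈
    ... | b′∈U , b≢b′ = begin
      s * pairSize (t , p) (u , q) ≡⟨ cong (s *_) (∑-grid-χ*χ m (box s (t , p)) (box s (u , q))) ⟩
      s * boxIntersectionSize m (box s (t , p)) (box s (u , q))
        ≤⟨ s*blockIntersectionSize≤ s k t p u q (proj₁ vb) (proj₁ vb′) (InB⇒within vb) (InB⇒within vb′) b≢b′ ⟩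
      m * 𝟙 (meets? (t , p) (u , q)) ∎
      where
      vb = All.lookup valid b∈
      vb′ = All.lookup valid b′∈U

  bounds : ∀ {n} → Vec ℕ n → Vec ℕ n
  bounds = V.map (λ a → s ^ (k ∸ a))

  positions : Vec ℕ d → List (Vec ℕ d)
  positions t = cells (bounds t)

  blocksOver : List (Vec ℕ d) → List (Block d)
  blocksOver = concatMap (λ t → map (t ,_) (positions t))

  ∈-blocksOver⁺ : ∀ {Ts t p} → t ∈ Ts → (∀ i → lookup p i < s ^ (k ∸ lookup t i)) → (t , p) ∈ blocksOver Ts
  ∈-blocksOver⁺ {t = t} {p} t∈ p< =
    ∈-concatMap⁺ (λ t → map (t ,_) (positions t)) (Any.map (λ { refl → ∈-map⁺ (t ,_) (∈-cells⁺ (bounds t) p<′) }) t∈)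
    where
    p<′ : ∀ i → lookup p i < lookup (bounds t) i
    p<′ i = subst (lookup p i <_) (sym (lookup-map i _ t)) (p< i)

  ∈-blocksOver⁻ : ∀ {Ts t p} → (t , p) ∈ blocksOver Ts → t ∈ Ts × (∀ i → lookup p i < s ^ (k ∸ lookup t i))
  ∈-blocksOver⁻ {Ts} {t} {p} b∈ with find (∈-concatMap⁻ (λ t → map (t ,_) (positions t)) {xs = Ts} b∈)
  ... | t′ , t′∈ , b∈′ with ∈-map⁻ (t′ ,_) b∈′
  ...   | p′ , p′∈ , refl = t′∈ , λ i → subst (lookup p i <_) (lookup-map i _ t) (∈-cells⁻ (bounds t) p′∈ i)

  length-cells-bounds : ∀ {n} (t : Vec ℕ n) → length (cells (bounds t)) ≡ s ^ V.sum (V.map (k ∸_) t)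
  length-cells-bounds []      = refl
  length-cells-bounds (a ∷ t) = trans (length-cells-∷ (s ^ (k ∸ a)) (bounds t))
    (trans (cong (s ^ (k ∸ a) *_) (length-cells-bounds t)) (sym (^-distribˡ-+-* s (k ∸ a) _)))

  length-positions : ∀ t → InT d k t → length (positions t) ≡ M
  length-positions t Σt = begin
    length (positions t)         ≡⟨ length-cells-bounds t ⟩
    s ^ V.sum (V.map (k ∸_) t)   ≡⟨ cong (s ^_) complement ⟩
    s ^ ((d ∸ 1) * k)            ≡⟨ cong (s ^_) (*-comm (d ∸ 1) k) ⟩
    s ^ (k * (d ∸ 1))            ≡⟨ ^-*-assoc s k (d ∸ 1) ⟨
    M                            ∎
    where
    open ≡-Reasoning
    complement : V.sum (V.map (k ∸_) t) ≡ (d ∸ 1) * k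
    complement = begin
      V.sum (V.map (k ∸_) t)           ≡⟨ m+n∸n≡m _ k ⟨
      V.sum (V.map (k ∸_) t) + k ∸ k   ≡⟨ cong (λ x → V.sum (V.map (k ∸_) t) + x ∸ k) Σt ⟨
      V.sum (V.map (k ∸_) t) + V.sum t ∸ k ≡⟨ cong (_∸ k) (sum-∸-complement k t (InT⇒≤ t Σt)) ⟩
      d * k ∸ k                        ≡⟨ cong (d * k ∸_) (*-identityˡ k) ⟨
      d * k ∸ 1 * k                    ≡⟨ *-distribʳ-∸ k d 1 ⟨
      (d ∸ 1) * k                      ∎

  length-blocksOver : ∀ {Ts} → All (InT d k) Ts → length (blocksOver Ts) ≡ M * length Ts
  length-blocksOver {Ts} inT = begin
    length (blocksOver Ts)                           ≡⟨ length-concatMap (λ t → map (t ,_) (positions t)) Ts ⟩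
    ∑ Ts (λ t → length (map (t ,_) (positions t)))
      ≡⟨ ∑-cong Ts (λ {t} t∈ → trans (length-map (t ,_) (positions t)) (length-positions t (All.lookup inT t∈))) ⟩
    ∑ Ts (λ _ → M)                                   ≡⟨ ∑-const Ts M ⟩
    M * length Ts                                    ∎
    where open ≡-Reasoning

  Independent⇒IsIndependent : ∀ {I} → Independent d s k I → IsIndependent I
  Independent⇒IsIndependent (_ , indep) {t , p} {u , q} v∈ w∈ v≢w meet =
    indep _ _ v∈ w∈ (v≢w , meet⇒intersect s t p u q meet)

  module Universe (Ts : List (Vec ℕ d)) (Ts↔T : ∀ t → (t ∈ Ts) ⇔ InT d k t) where

    U₀ : List (Block d)
    U₀ = deduplicate _≟ᴮ_ (blocksOver Ts)

    U₀-! : Unique U₀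
    U₀-! = deduplicate-! _≟ᴮ_ (blocksOver Ts)

    U₀⊆InB : ∀ {b} → b ∈ U₀ → InB d s k b
    U₀⊆InB {t , p} b∈ with ∈-blocksOver⁻ (∈-deduplicate⁻ _≟ᴮ_ (blocksOver Ts) b∈)
    ... | t∈ , p< = Equivalence.to (Ts↔T t) t∈ , p<

    InB⇒∈U₀ : ∀ {b} → InB d s k b → b ∈ U₀
    InB⇒∈U₀ {t , p} (Σt , p<) = ∈-deduplicate⁺ _≟ᴮ_ (∈-blocksOver⁺ (Equivalence.from (Ts↔T t) Σt) p<)

    length-U₀ : length U₀ ≤ M * length Ts
    length-U₀ = ≤-trans (length-deduplicate _≟ᴮ_ (blocksOver Ts))
                        (≤-reflexive (length-blocksOver (All.tabulate (λ {t} t∈ → Equivalence.to (Ts↔T t) t∈))))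

    U₀-sparse : 1 ≤ d → Sparse U₀ (2 * M)
    U₀-sparse d≥1 =
      overlap-bound⇒sparse (λ u U⊆U₀ → overlap-bound d≥1 u (All.tabulate (λ b∈ → U₀⊆InB (U⊆U₀ b∈))))

    block-containers : 1 ≤ d →
      Σ (List (List (Block d))) λ 𝓒 →
        All (All (InB d s k)) 𝓒
        × All (λ C → length C ≤ 2 * (M * length Ts) / s + 2 * M) 𝓒
        × length 𝓒 ^ s ≤ suc (M * length Ts) ^ (2 * (M * length Ts))
        × (∀ I → Independent d s k I → Any (λ C → ∀ b → b ∈ I → b ∈ C) 𝓒)
    block-containers d≥1 with 𝓒 , 𝓒⊆U₀ , size , number , cover ← containers U₀-! (U₀-sparse d≥1) =
      𝓒 ,
      All.map (λ C⊆U₀ → All.tabulate (λ b∈ → U₀⊆InB (C⊆U₀ b∈))) 𝓒⊆U₀ ,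
      All.map (λ |C|≤ → ≤-trans |C|≤ (+-monoˡ-≤ (2 * M) (/-monoˡ-≤ s (*-monoʳ-≤ 2 length-U₀)))) size ,
      count ,
      λ I I-indep → Any.map (λ I⊆C _ b∈ → I⊆C b∈)
        (cover (Independent⇒IsIndependent I-indep) (λ b∈ → InB⇒∈U₀ (All.lookup (proj₁ I-indep) b∈)))
      where
      n₀ = length U₀
      count : length 𝓒 ^ s ≤ suc (M * length Ts) ^ (2 * (M * length Ts))
      count = begin
        length 𝓒 ^ s                          ≤⟨ ^-monoˡ-≤ s number ⟩
        (suc n₀ ^ (2 * n₀ / s)) ^ s           ≡⟨ ^-*-assoc (suc n₀) (2 * n₀ / s) s ⟩
        suc n₀ ^ (2 * n₀ / s * s)             ≤⟨ ^-monoʳ-≤ (suc n₀) (m/n*n≤m (2 * n₀) s) ⟩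
        suc n₀ ^ (2 * n₀)                     ≤⟨ ^-monoˡ-≤ (2 * n₀) (s≤s length-U₀) ⟩
        suc (M * length Ts) ^ (2 * n₀)        ≤⟨ ^-monoʳ-≤ (suc (M * length Ts)) (*-monoʳ-≤ 2 length-U₀) ⟩
        suc (M * length Ts) ^ (2 * (M * length Ts)) ∎
        where open ≤-Reasoning

length≥injection : ∀ {A : Set} {n} {xs : List A} (f : Fin n → A) →
  (∀ {i j} → f i ≡ f j → i ≡ j) → (∀ i → f i ∈ xs) → n ≤ length xs
length≥injection {n = n} {xs} f f-injective f∈ with n ≤? length xs
... | yes n≤ = n≤
... | no  n≰ with i , j , i<j , same-index ← pigeonhole (≰⇒> n≰) (λ i → Any.index (f∈ i)) =
  contradiction (f-injective (begin
    f i                          ≡⟨ Any.lookup-index (f∈ i) ⟩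
    Data.List.lookup xs (Any.index (f∈ i)) ≡⟨ cong (Data.List.lookup xs) same-index ⟩
    Data.List.lookup xs (Any.index (f∈ j)) ≡⟨ Any.lookup-index (f∈ j) ⟨
    f j                          ∎)) (<⇒≢ᶠ i<j)
  where open ≡-Reasoning

|T|>k : ∀ e k {nT} → HasSize (InT (2 + e) k) nT → k < nT
|T|>k e k (Ts , _ , Ts↔T , refl) =
  length≥injection corner (λ same → toℕ-injective (cong V.head same)) (λ i → Equivalence.from (Ts↔T (corner i)) (corner-InT i))
  where
  corner : Fin (suc k) → Vec ℕ (2 + e)
  corner i = toℕ i ∷ (k ∸ toℕ i) ∷ replicate e 0
  sum-zeros : ∀ n → V.sum (replicate n 0) ≡ 0
  sum-zeros zero    = refl
  sum-zeros (suc n) = sum-zeros n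
  corner-InT : ∀ i → InT (2 + e) k (corner i)
  corner-InT i = trans (cong (λ z → toℕ i + (k ∸ toℕ i + z)) (sum-zeros e))
                       (trans (cong (toℕ i +_) (+-identityʳ _)) (m+[n∸m]≡n (toℕ≤pred[n] i)))

exponent-bound : ∀ d k n M → 2 * suc d ≤ k → k < n → (1 + k * d) * (2 * (M * n)) ≤ M * n ^ 3
exponent-bound d k n M 2d≤k k<n = begin
  (1 + k * d) * (2 * (M * n))  ≡⟨ rearrange (1 + k * d) M n ⟩
  M * (n * (2 * (1 + k * d)))  ≤⟨ *-monoʳ-≤ M (*-monoʳ-≤ n twice-E≤) ⟩
  M * (n * (n * n))            ≡⟨ cong (λ z → M * (n * (n * z))) (*-identityʳ n) ⟨
  M * n ^ 3                    ∎
  where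
  open ≤-Reasoning
  rearrange : ∀ E M n → E * (2 * (M * n)) ≡ M * (n * (2 * E))
  rearrange = solve-∀
  collect : ∀ k d → 2 * (k + k * d) ≡ 2 * suc d * k
  collect = solve-∀
  twice-E≤ : 2 * (1 + k * d) ≤ n * n
  twice-E≤ = begin
    2 * (1 + k * d)    ≤⟨ *-monoʳ-≤ 2 (+-monoˡ-≤ (k * d) (≤-trans (s≤s z≤n) 2d≤k)) ⟩
    2 * (k + k * d)    ≡⟨ collect k d ⟩
    2 * suc d * k      ≤⟨ *-monoˡ-≤ k 2d≤k ⟩
    k * k              ≤⟨ *-mono-≤ (<⇒≤ k<n) (<⇒≤ k<n) ⟩
    n * n              ∎

ContainerFamily : (d s k nT : ℕ) → Set
ContainerFamily d s k nT =
  Σ (List (List (Block d))) λ 𝓒 →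
    All (All (InB d s k)) 𝓒
    × All (λ C → length C ≤ 3 * ((s ^ k) ^ (d ∸ 1))) 𝓒
    × (length 𝓒 ^ s ≤ s ^ (((s ^ k) ^ (d ∸ 1)) * nT ^ 3))
    × (∀ (I : List (Block d)) → Independent d s k I → Any (λ C → ∀ b → b ∈ I → b ∈ C) 𝓒)

containerFamily : ∀ e s k nT .{{_ : NonZero s}} → 2 * (3 + e) ≤ k → HasSize (InT (3 + e) k) nT → nT ^ 3 ≤ s →
                  ContainerFamily (3 + e) s k nT
containerFamily e s k nT 2d≤k T-size@(Ts , _ , Ts↔T , refl) nT³≤s
  with 𝓒 , 𝓒-InB , size , number , cover ← BlockGraph.Universe.block-containers (3 + e) s k Ts Ts↔T (s≤s z≤n) =
  𝓒 , 𝓒-InB , All.map (λ |C|≤ → ≤-trans |C|≤ size-bound) size , ≤-trans number number-bound , cover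
  where
  M = (s ^ k) ^ (2 + e)
  k<nT : k < nT
  k<nT = |T|>k (1 + e) k T-size
  instance
    nT≢0 : NonZero nT
    nT≢0 = >-nonZero (≤-<-trans z≤n k<nT)
  2nT≤s : 2 * nT ≤ s
  2nT≤s = begin
    2 * nT       ≤⟨ *-monoˡ-≤ nT (≤-trans (s≤s (s≤s z≤n)) (≤-trans (m≤n*m (3 + e) 2) (≤-trans 2d≤k (<⇒≤ k<nT)))) ⟩
    nT * nT      ≡⟨ cong (nT *_) (*-identityʳ nT) ⟨
    nT ^ 2       ≤⟨ ^-monoʳ-≤ nT (n≤1+n 2) ⟩
    nT ^ 3       ≤⟨ nT³≤s ⟩
    s            ∎
    where open ≤-Reasoning
  size-bound : 2 * (M * nT) / s + 2 * M ≤ 3 * M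
  size-bound = +-monoˡ-≤ (2 * M) (begin
    2 * (M * nT) / s  ≡⟨ cong (_/ s) (x*[y*z]≡y*[x*z] 2 M nT) ⟩
    M * (2 * nT) / s  ≤⟨ /-monoˡ-≤ s (*-monoʳ-≤ M 2nT≤s) ⟩
    M * s / s         ≡⟨ m*n/n≡m M s ⟩
    M                 ∎)
    where
    open ≤-Reasoning
  number-bound : suc (M * nT) ^ (2 * (M * nT)) ≤ s ^ (M * nT ^ 3)
  number-bound = begin
    suc (M * nT) ^ (2 * (M * nT))        ≤⟨ ^-monoˡ-≤ (2 * (M * nT)) (begin
        suc (M * nT)  ≤⟨ +-monoˡ-≤ (M * nT) (m^n>0 (s ^ k) {{m^n≢0 s k}} (2 + e)) ⟩
        M + M * nT    ≡⟨ *-suc M nT ⟨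
        M * suc nT    ≤⟨ *-monoʳ-≤ M (≤-trans (+-monoˡ-≤ nT (>-nonZero⁻¹ nT)) (subst (_≤ s) (cong (nT +_) (+-identityʳ nT)) 2nT≤s)) ⟩
        M * s         ≡⟨ *-comm M s ⟩
        s * M         ≡⟨ cong (s *_) (^-*-assoc s k (2 + e)) ⟩
        s ^ (1 + k * (2 + e)) ∎) ⟩
    (s ^ (1 + k * (2 + e))) ^ (2 * (M * nT)) ≡⟨ ^-*-assoc s (1 + k * (2 + e)) (2 * (M * nT)) ⟩
    s ^ ((1 + k * (2 + e)) * (2 * (M * nT))) ≤⟨ ^-monoʳ-≤ s (exponent-bound (2 + e) k nT M 2d≤k k<nT) ⟩
    s ^ (M * nT ^ 3)                      ∎
    where open ≤-Reasoning

lemma6 : (d : ℕ) → 3 ≤ d →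
    ∃[ N ] (∀ (s k : ℕ) → 1 ≤ s → 1 ≤ k → N ≤ s → N ≤ k →
    ∀ (nT : ℕ) → HasSize (InT d k) nT →
    nT ^ 3 ≤ s →
    Σ (List (List (Block d))) λ 𝓒 →
    All (All (InB d s k)) 𝓒
    × All (λ C → length C ≤ 3 * ((s ^ k) ^ (d ∸ 1))) 𝓒
    × (length 𝓒 ^ s ≤ s ^ (((s ^ k) ^ (d ∸ 1)) * nT ^ 3))
    × (∀ (I : List (Block d)) → Independent d s k I →
    Any (λ C → ∀ b → b ∈ I → b ∈ C) 𝓒))
lemma6 zero             ()
lemma6 (suc zero)       (s≤s ())
lemma6 (suc (suc zero)) (s≤s (s≤s ()))
lemma6 (suc (suc (suc e))) _ =
  2 * (3 + e) , λ s k 1≤s _ _ 2d≤k nT T-size nT³≤s → containerFamily e s k nT {{>-nonZero 1≤s}} 2d≤k T-size nT³≤s
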